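{- In the Slow Flashcard Game, for every integer $i\ge 2$ we have \[ T_1(i-1)+i-1\le T_i(1)<T_1(i). \]
   Context: The Slow Flashcard Game is the following deterministic process with insertion sequence $p_k=k+1$. The state at each time $t=1,2,\dots$ consists of an ordering (the deck) of all positive integers (cards), positions numbered $1,2,\dots$ from the front, together with a counter for each card recording how many times it has been seen. At time $t=1$ the deck is $1,2,3,\dots$, card $1$ (at the front) has been seen once, and all other cards $0$ times. To pass from time $t$ to $t+1$: if the front card has been seen $k$ times so far, remove it and reinsert it so that it occupies position $p_k=k+1$; then the card now at the front has its counter increased by one (it is seen at time $t+1$). For $n,k\ge1$, $T_n(k)$ denotes the time at which card $n$ is seen for the $k$-th time. -}

module Defs where

open import Data.Nat using (ℕ; zero; suc; _∸_; _≤_)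
open import Data.Product using (_×_; _,_; proj₁; proj₂)
open import Data.List using (List; []; _∷_)
open import Relation.Binary.PropositionalEquality using (_≡_)

-- A card together with its "seen" counter.
Card : Set
Card = ℕ × ℕ

-- The (infinite) deck is represented as: the front card, then a finite list
-- of cards, then all cards next, next+1, next+2, ... in increasing order,
-- each with counter 0 (these have never been touched).
record State : Set where
  constructor st
  field
    front : Card
    rest  : List Card
    next  : ℕ
open State public

-- insertAt j x xs n : insert x so that exactly j cards precede it, where the
-- deck after the finite list xs continues with n, n+1, ... (counters 0).
insertAt : ℕ → Card → List Card → ℕ → List Card × ℕ
insertAt zero    x xs       n = (x ∷ xs) , n
insertAt (suc j) x []       n with insertAt j x [] (suc n)
... | l , n' = ((n , 0) ∷ l) , n'
insertAt (suc j) x (y ∷ ys) n with insertAt j x ys n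
... | l , n' = (y ∷ l) , n'

seeFront : List Card → ℕ → State
seeFront []              n = st (n , 1) [] (suc n)
seeFront ((c , k) ∷ ys)  n = st (c , suc k) ys n

-- One step: the front card, seen k times, is removed and reinserted at
-- position p_k = k + 1 (i.e. with k cards in front of it); then the new front
-- card is seen.
step : State → State
step (st (c , k) r n) with insertAt k (c , k) r n
... | l , n' = seeFront l n'

-- State at time 1: deck 1,2,3,..., card 1 seen once, others 0 times.
initial : State
initial = st (1 , 1) [] 2

-- stateAt m is the state at time t = m + 1.
stateAt : ℕ → State
stateAt zero    = initial
stateAt (suc m) = step (stateAt m)

-- IsT n k t : card n is seen for the k-th time at time t, i.e. T_n(k) = t.
-- (At each time exactly the front card is seen; its counter then equals the
-- number of times it has been seen so far.)
IsT : ℕ → ℕ → ℕ → Set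
IsT n k t = (1 ≤ t) × (front (stateAt (t ∸ 1)) ≡ (n , k))

-- At time T₁(k) the deck is card 1 (seen k times), then the cards 2, …, k,
-- each seen fewer than k times, then the unseen cards k+1, k+2, ….  Card 1 is
-- reinserted just behind card k+1.  Until card 1 comes back to the front, the
-- front card is seen c ≤ k times and is reinserted at position c+1, either
-- still ahead of card 1 or behind it; a weight on the cards ahead of card 1
-- drops at every step, so card 1 does come back, and then the deck has the
-- same shape for k+1.  Card k+1 starts that round at position k and moves at
-- most one place forward per step, so it is seen no earlier than T₁(k) + k;
-- being ahead of card 1 until it is seen, it is seen before T₁(k+1).
module Submission where

open import Data.List using (List; []; _∷_; _++_; length)
open import Data.List.Properties using (length-++)
open import Data.List.Relation.Unary.All as All using (All; []; _∷_)
open import Data.List.Relation.Unary.All.Properties using (∷ʳ⁺)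
open import Data.Nat using (ℕ; zero; suc; _+_; _∸_; _≤_; _<_; z≤n; s≤s)
open import Data.Nat.Induction using (<-wellFounded)
open import Data.Nat.Properties
open import Algebra.Properties.CommutativeSemigroup +-commutativeSemigroup
  using (x∙yz≈y∙xz)
open import Data.Product using (_×_; _,_; proj₁; proj₂; Σ-syntax; ∃-syntax)
open import Data.Sum using (_⊎_; inj₁; inj₂)
open import Function using (_∘_)
open import Induction.WellFounded using (Acc; acc)
open import Relation.Binary.PropositionalEquality
  using (_≡_; refl; sym; trans; cong; _≗_; module ≡-Reasoning)

open import Defs

module _ {A : Set} where

  infixr 5 _++ˢ_

  _++ˢ_ : List A → (ℕ → A) → ℕ → A
  ([] ++ˢ g) i = g i
  ((x ∷ xs) ++ˢ g) zero = x
  ((x ∷ xs) ++ˢ g) (suc i) = (xs ++ˢ g) i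

  insertˢ : ℕ → A → (ℕ → A) → ℕ → A
  insertˢ zero    x g = (x ∷ []) ++ˢ g
  insertˢ (suc j) x g = (g 0 ∷ []) ++ˢ insertˢ j x (g ∘ suc)

  insertˢ-cong : ∀ j x {g h : ℕ → A} → g ≗ h → insertˢ j x g ≗ insertˢ j x h
  insertˢ-cong zero    x g≗h zero    = refl
  insertˢ-cong zero    x g≗h (suc i) = g≗h i
  insertˢ-cong (suc j) x g≗h zero    = g≗h 0
  insertˢ-cong (suc j) x g≗h (suc i) = insertˢ-cong j x (g≗h ∘ suc) i

  insert : ℕ → A → List A → List A
  insert zero    x ys       = x ∷ ys
  insert (suc j) x []       = x ∷ []
  insert (suc j) x (y ∷ ys) = y ∷ insert j x ys

  insertˢ-++ˢ : ∀ j x ys g → j ≤ length ys →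
                insertˢ j x (ys ++ˢ g) ≗ insert j x ys ++ˢ g
  insertˢ-++ˢ zero    x ys       g _         zero    = refl
  insertˢ-++ˢ zero    x ys       g _         (suc i) = refl
  insertˢ-++ˢ (suc j) x (y ∷ ys) g _         zero    = refl
  insertˢ-++ˢ (suc j) x (y ∷ ys) g (s≤s j≤n) (suc i) = insertˢ-++ˢ j x ys g j≤n i

  length-insert : ∀ j x ys → length (insert j x ys) ≡ suc (length ys)
  length-insert zero    x ys       = refl
  length-insert (suc j) x []       = refl
  length-insert (suc j) x (y ∷ ys) = cong suc (length-insert j x ys)

  insert-length : ∀ x ys → insert (length ys) x ys ≡ ys ++ x ∷ []
  insert-length x []       = refl
  insert-length x (y ∷ ys) = cong (y ∷_) (insert-length x ys)

  All-insert : ∀ {P : A → Set} j {x ys} → P x → All P ys → All P (insert j x ys)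
  All-insert zero    px pys         = px ∷ pys
  All-insert (suc j) px []          = px ∷ []
  All-insert (suc j) px (py ∷ pys) = py ∷ All-insert j px pys

  insert-++-∷ : ∀ j x xs z ys →
    (insert j x (xs ++ z ∷ ys) ≡ insert j x xs ++ z ∷ ys × j ≤ length xs)
    ⊎ insert j x (xs ++ z ∷ ys) ≡ xs ++ z ∷ insert (j ∸ suc (length xs)) x ys
  insert-++-∷ zero    x xs       z ys = inj₁ (refl , z≤n)
  insert-++-∷ (suc j) x []       z ys = inj₂ refl
  insert-++-∷ (suc j) x (w ∷ xs) z ys with insert-++-∷ j x xs z ys
  ... | inj₁ (eq , j≤n) = inj₁ (cong (w ∷_) eq , s≤s j≤n)
  ... | inj₂ eq         = inj₂ (cong (w ∷_) eq)

  length-++-∷ : ∀ xs (z : A) ys → length (xs ++ z ∷ ys) ≡ suc (length xs + length ys)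
  length-++-∷ xs z ys = trans (length-++ xs) (+-suc (length xs) (length ys))

  NoEarlier : A → List A → List A → Set
  NoEarlier z xs ys = ∀ us vs → xs ≡ us ++ z ∷ vs →
    ∃[ us′ ] ∃[ vs′ ] ys ≡ us′ ++ z ∷ vs′ × length us ≤ length us′

  NoEarlier-refl : ∀ z xs → NoEarlier z xs xs
  NoEarlier-refl z xs us vs eq = us , vs , eq , ≤-refl

  NoEarlier-insert : ∀ j x z xs → NoEarlier z xs (insert j x xs)
  NoEarlier-insert j x z _ us vs refl with insert-++-∷ j x us z vs
  ... | inj₁ (eq , _) = insert j x us , vs , eq ,
          ≤-trans (n≤1+n _) (≤-reflexive (sym (length-insert j x us)))
  ... | inj₂ eq       = us , _ , eq , ≤-refl

Deck : Set
Deck = ℕ → Card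

count : Card → ℕ
count = proj₂

see : Card → Card
see (n , k) = n , suc k

fresh : ℕ → Deck
fresh n zero    = n , 0
fresh n (suc i) = fresh (suc n) i

++ˢ-fresh : ∀ xs n → xs ++ˢ fresh n ≗ (xs ++ (n , 0) ∷ []) ++ˢ fresh (suc n)
++ˢ-fresh []       n zero    = refl
++ˢ-fresh []       n (suc i) = refl
++ˢ-fresh (x ∷ xs) n zero    = refl
++ˢ-fresh (x ∷ xs) n (suc i) = ++ˢ-fresh xs n i

-- deckOf s i is the card at position i + 1.
deckOf : State → Deck
deckOf s = (front s ∷ rest s) ++ˢ fresh (next s)

deckAt : ℕ → Deck
deckAt m = deckOf (stateAt m)

seeFrontˢ : Deck → Deck
seeFrontˢ g = (see (g 0) ∷ []) ++ˢ (g ∘ suc)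

seeFrontˢ-cong : ∀ {g h} → g ≗ h → seeFrontˢ g ≗ seeFrontˢ h
seeFrontˢ-cong g≗h zero    = cong see (g≗h 0)
seeFrontˢ-cong g≗h (suc i) = g≗h (suc i)

seeFrontˢ-++ˢ : ∀ y ys g → seeFrontˢ ((y ∷ ys) ++ˢ g) ≗ (see y ∷ ys) ++ˢ g
seeFrontˢ-++ˢ y ys g zero    = refl
seeFrontˢ-++ˢ y ys g (suc i) = refl

insertAt≗insertˢ : ∀ j x r n →
  proj₁ (insertAt j x r n) ++ˢ fresh (proj₂ (insertAt j x r n)) ≗ insertˢ j x (r ++ˢ fresh n)
insertAt≗insertˢ zero    x r       n zero    = refl
insertAt≗insertˢ zero    x r       n (suc i) = refl
insertAt≗insertˢ (suc j) x []      n zero    = refl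
insertAt≗insertˢ (suc j) x []      n (suc i) = insertAt≗insertˢ j x [] (suc n) i
insertAt≗insertˢ (suc j) x (y ∷ r) n zero    = refl
insertAt≗insertˢ (suc j) x (y ∷ r) n (suc i) = insertAt≗insertˢ j x r n i

seeFront≗seeFrontˢ : ∀ l n → deckOf (seeFront l n) ≗ seeFrontˢ (l ++ˢ fresh n)
seeFront≗seeFrontˢ []      n zero    = refl
seeFront≗seeFrontˢ []      n (suc i) = refl
seeFront≗seeFrontˢ (x ∷ l) n zero    = refl
seeFront≗seeFrontˢ (x ∷ l) n (suc i) = refl

deckOf-step : ∀ s → deckOf (step s) ≗
  seeFrontˢ (insertˢ (count (front s)) (front s) (rest s ++ˢ fresh (next s)))
deckOf-step (st (c , k) r n) i =
  trans (seeFront≗seeFrontˢ (proj₁ inserted) (proj₂ inserted) i)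
        (seeFrontˢ-cong (insertAt≗insertˢ k (c , k) r n) i)
  where
  inserted : List Card × ℕ
  inserted = insertAt k (c , k) r n

deckOf-step-++ˢ : ∀ s {x ys y zs g} → deckOf s ≗ (x ∷ ys) ++ˢ g → count x ≤ length ys →
  insert (count x) x ys ≡ y ∷ zs → deckOf (step s) ≗ (see y ∷ zs) ++ˢ g
deckOf-step-++ˢ (st f r n) {ys = ys} {y} {zs} {g} s≗ f≤ys inserted with s≗ 0
... | refl = λ i → begin
  deckOf (step (st f r n)) i                         ≡⟨ deckOf-step (st f r n) i ⟩
  seeFrontˢ (insertˢ (count f) f (r ++ˢ fresh n)) i
    ≡⟨ seeFrontˢ-cong (insertˢ-cong (count f) f (s≗ ∘ suc)) i ⟩
  seeFrontˢ (insertˢ (count f) f (ys ++ˢ g)) i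
    ≡⟨ seeFrontˢ-cong (insertˢ-++ˢ (count f) f ys g f≤ys) i ⟩
  seeFrontˢ (insert (count f) f ys ++ˢ g) i          ≡⟨ cong (λ l → seeFrontˢ (l ++ˢ g) i) inserted ⟩
  seeFrontˢ ((y ∷ zs) ++ˢ g) i                       ≡⟨ seeFrontˢ-++ˢ y zs g i ⟩
  ((see y ∷ zs) ++ˢ g) i                             ∎
  where open ≡-Reasoning

-- Round k runs from step m₀, where card 1 is seen for the k-th time; its new
-- card is k + 1.
NewCardSeen : (k m₀ m : ℕ) → Set
NewCardSeen k m₀ m = ∃[ t ] m₀ + k ≤ t × t ≤ m × front (stateAt t) ≡ (suc k , 1)

-- Cards move at most one place forward per step, so from position 2 + length us
-- the new card cannot reach the front before step m + 1 + length us.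
NewCardWaiting : (k m₀ m : ℕ) → List Card → Set
NewCardWaiting k m₀ m F = ∃[ x ] ∃[ us ] ∃[ vs ]
  F ≡ x ∷ us ++ (suc k , 0) ∷ vs × m₀ + k ≤ m + suc (length us)

NewCardTracked : (k m₀ m : ℕ) → List Card → Set
NewCardTracked k m₀ m F = NewCardSeen k m₀ m ⊎ NewCardWaiting k m₀ m F

NewCardTracked-step : ∀ {k m₀ m x y L L′} → NewCardTracked k m₀ m (x ∷ y ∷ L) →
  front (stateAt (suc m)) ≡ see y → NoEarlier (suc k , 0) L L′ →
  NewCardTracked k m₀ (suc m) (see y ∷ L′)
NewCardTracked-step (inj₁ (t , m₀+k≤t , t≤m , seen)) _ _ =
  inj₁ (t , m₀+k≤t , m≤n⇒m≤1+n t≤m , seen)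
NewCardTracked-step {m = m} (inj₂ (_ , [] , _ , refl , bound)) seen _ =
  inj₁ (suc m , ≤-trans bound (≤-reflexive (+-comm m 1)) , ≤-refl , seen)
NewCardTracked-step {m = m} (inj₂ (_ , _ ∷ us , vs , refl , bound)) _ keeps
  with keeps us vs refl
... | us′ , vs′ , eq , us≤us′ = inj₂ (_ , us′ , vs′ , cong (_ ∷_) eq ,
  ≤-trans bound (≤-trans (≤-reflexive (+-suc m _)) (s≤s (+-monoʳ-≤ m (s≤s us≤us′)))))

NewCardTracked-alone : ∀ {k m₀ m x} → NewCardTracked k m₀ m (x ∷ []) → NewCardSeen k m₀ m
NewCardTracked-alone (inj₁ seen)                 = seen
NewCardTracked-alone (inj₂ (_ , []    , _ , () , _))
NewCardTracked-alone (inj₂ (_ , _ ∷ _ , _ , () , _))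

record OneAtFront (k m : ℕ) : Set where
  constructor oneAtFront
  field
    others   : List Card
    deck≗    : deckAt m ≗ ((1 , k) ∷ others) ++ˢ fresh (suc k)
    size     : suc (length others) ≡ k
    others<k : All (λ y → count y < k) others

record Midround (k m : ℕ) : Set where
  constructor midround
  field
    a c           : ℕ
    ahead behind  : List Card
    deck≗         : deckAt m ≗ ((a , suc c) ∷ ahead ++ (1 , k) ∷ behind) ++ˢ fresh (2 + k)
    front<k       : c < k
    ahead<k       : All (λ y → count y < k) ahead
    behind≤k      : All (λ y → count y ≤ k) behind
    size          : suc (length ahead + length behind) ≡ k

aheadOfOne : ∀ {k m} → Midround k m → List Card
aheadOfOne p = (a , suc c) ∷ ahead
  where open Midround p

weight : ℕ → List Card → ℕ
weight k []       = 0
weight k (y ∷ ys) = suc (k ∸ count y) + weight k ys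

weight-insert : ∀ k j x ys → weight k (insert j x ys) ≡ weight k (x ∷ ys)
weight-insert k zero    x ys       = refl
weight-insert k (suc j) x []       = refl
weight-insert k (suc j) x (y ∷ ys) =
  trans (cong (suc (k ∸ count y) +_) (weight-insert k j x ys))
        (x∙yz≈y∙xz (suc (k ∸ count y)) (suc (k ∸ count x)) (weight k ys))

weight-see : ∀ k x y L L′ → count y < k → weight k L′ ≤ weight k (x ∷ L) →
  weight k (see y ∷ L′) < weight k (x ∷ y ∷ L)
weight-see k x (n , d) L L′ d<k L′≤ = begin-strict
  suc (k ∸ suc d) + weight k L′                         ≤⟨ +-monoʳ-≤ _ L′≤ ⟩
  suc (k ∸ suc d) + (suc (k ∸ count x) + weight k L)
    ≡⟨ x∙yz≈y∙xz (suc (k ∸ suc d)) (suc (k ∸ count x)) (weight k L) ⟩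
  suc (k ∸ count x) + (suc (k ∸ suc d) + weight k L)
    <⟨ +-monoʳ-< (suc (k ∸ count x)) (+-monoˡ-< (weight k L) (s≤s (∸-monoʳ-< ≤-refl d<k))) ⟩
  suc (k ∸ count x) + (suc (k ∸ d) + weight k L)        ∎
  where open ≤-Reasoning

leaveFront : ∀ {k m} ys → deckAt m ≗ ((1 , k) ∷ ys) ++ˢ fresh (2 + k) → length ys ≡ k →
  All (λ y → count y < k) ys → NewCardWaiting k m m ((1 , k) ∷ ys) →
  Σ[ p ∈ Midround k (suc m) ] NewCardTracked k m (suc m) (aheadOfOne p)
leaveFront [] _ _ _ (_ , []    , _ , () , _)
leaveFront [] _ _ _ (_ , _ ∷ _ , _ , () , _)
leaveFront {k} {m} ((b , d) ∷ L) deck≗ refl (d<k ∷ L<k) waiting =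
  midround b d L [] deck≗′ d<k L<k [] (cong suc (+-identityʳ _)) ,
  NewCardTracked-step (inj₂ waiting) (deck≗′ 0) (NoEarlier-refl _ L)
  where
  deck≗′ : deckAt (suc m) ≗ ((b , suc d) ∷ L ++ (1 , k) ∷ []) ++ˢ fresh (2 + k)
  deck≗′ = deckOf-step-++ˢ (stateAt m) deck≗ ≤-refl (insert-length (1 , k) ((b , d) ∷ L))

startRound : ∀ {k m} → OneAtFront k m →
  Σ[ p ∈ Midround k (suc m) ] NewCardTracked k m (suc m) (aheadOfOne p)
startRound {m = m} (oneAtFront R deck≗ refl R<k) =
  leaveFront (R ++ (suc k , 0) ∷ []) (λ i → trans (deck≗ i) (++ˢ-fresh ((1 , k) ∷ R) (suc k) i))
    (trans (length-++ R) (+-comm (length R) 1)) (∷ʳ⁺ R<k (s≤s z≤n))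
    ((1 , k) , R , [] , refl , ≤-refl)
  where
  k : ℕ
  k = suc (length R)

<-length-++-∷ : ∀ {c k} xs (z : Card) ys → c < k → suc (length xs + length ys) ≡ k →
  c < length (xs ++ z ∷ ys)
<-length-++-∷ xs z ys c<k size =
  ≤-trans c<k (≤-reflexive (sym (trans (length-++-∷ xs z ys) size)))

Advanced : (k m₀ m : ℕ) → Midround k m → Set
Advanced k m₀ m p =
  (NewCardSeen k m₀ m × OneAtFront (suc k) (suc m))
  ⊎ (Σ[ p′ ∈ Midround k (suc m) ]
       weight k (aheadOfOne p′) < weight k (aheadOfOne p) × NewCardTracked k m₀ (suc m) (aheadOfOne p′))

advance : ∀ {k m₀ m} (p : Midround k m) → NewCardTracked k m₀ m (aheadOfOne p) → Advanced k m₀ m p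
advance {m = m} (midround a c [] M deck≗ c<k [] M≤k refl) tracked =
  inj₁ (NewCardTracked-alone tracked ,
        oneAtFront (insert c (a , suc c) M) (deckOf-step-++ˢ (stateAt m) deck≗ c<k refl)
          (cong suc (length-insert c _ M)) (All-insert c (s≤s c<k) (All.map s≤s M≤k)))
advance {k} {m = m} (midround a c ((b , d) ∷ L) M deck≗ c<k (d<k ∷ L<k) M≤k size) tracked
  with insert-++-∷ c (a , suc c) L (1 , k) M
... | inj₁ (inserted , c≤L) =
  inj₂ (midround b d (insert c x L) M deck≗′ d<k (All-insert c x<k L<k) M≤k size′ ,
        weight-see k x (b , d) L (insert c x L) d<k (≤-reflexive (weight-insert k c x L)) ,
        NewCardTracked-step tracked (deck≗′ 0) (NoEarlier-insert c x _ L))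
  where
  x : Card
  x = (a , suc c)
  deck≗′ : deckAt (suc m) ≗ ((b , suc d) ∷ insert c x L ++ (1 , k) ∷ M) ++ˢ fresh (2 + k)
  deck≗′ = deckOf-step-++ˢ (stateAt m) deck≗ (<-length-++-∷ ((b , d) ∷ L) (1 , k) M c<k size)
             (cong ((b , d) ∷_) inserted)
  x<k : suc c < k
  x<k = ≤-trans (s≤s (s≤s (≤-trans c≤L (m≤m+n _ _)))) (≤-reflexive size)
  size′ : suc (length (insert c x L) + length M) ≡ k
  size′ = trans (cong (λ n → suc (n + length M)) (length-insert c x L)) size
... | inj₂ inserted =
  inj₂ (midround b d L (insert j x M) deck≗′ d<k L<k (All-insert j c<k M≤k) size′ ,
        weight-see k x (b , d) L L d<k (m≤n+m _ _) ,
        NewCardTracked-step tracked (deck≗′ 0) (NoEarlier-refl _ L))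
  where
  x : Card
  x = (a , suc c)
  j : ℕ
  j = c ∸ suc (length L)
  deck≗′ : deckAt (suc m) ≗ ((b , suc d) ∷ L ++ (1 , k) ∷ insert j x M) ++ˢ fresh (2 + k)
  deck≗′ = deckOf-step-++ˢ (stateAt m) deck≗ (<-length-++-∷ ((b , d) ∷ L) (1 , k) M c<k size)
             (cong ((b , d) ∷_) inserted)
  size′ : suc (length L + length (insert j x M)) ≡ k
  size′ = trans (cong (λ n → suc (length L + n)) (length-insert j x M))
                (trans (cong suc (+-suc (length L) (length M))) size)

finishRound : ∀ {k m₀ m} (p : Midround k m) → Acc _<_ (weight k (aheadOfOne p)) →
  NewCardTracked k m₀ m (aheadOfOne p) → ∃[ m′ ] NewCardSeen k m₀ m′ × OneAtFront (suc k) (suc m′)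
finishRound p (acc smaller) tracked with advance p tracked
... | inj₁ done                       = _ , done
... | inj₂ (p′ , lighter , tracked′) = finishRound p′ (smaller lighter) tracked′

round : ∀ {k m} → OneAtFront k m → ∃[ m′ ] NewCardSeen k m m′ × OneAtFront (suc k) (suc m′)
round one with startRound one
... | p , tracked = finishRound p (<-wellFounded _) tracked

oneAtFront-reachable : ∀ j → ∃[ m ] OneAtFront (suc j) m
oneAtFront-reachable zero = 0 , oneAtFront [] (λ _ → refl) refl []
oneAtFront-reachable (suc j) with oneAtFront-reachable j
... | m , one with round one
... | m′ , _ , one′ = suc m′ , one′

mainTheorem2 : (i : ℕ) → 2 ≤ i →
    ∃[ t₁ ] ∃[ t₂ ] ∃[ t₃ ]
      (IsT 1 (i ∸ 1) t₁ × IsT i 1 t₂ × IsT 1 i t₃ ×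
       (t₁ + (i ∸ 1) ≤ t₂) × (t₂ < t₃))
mainTheorem2 (suc zero) (s≤s ())
mainTheorem2 (suc (suc j)) _ with oneAtFront-reachable j
... | m , one with round one
... | m′ , (t , m+k≤t , t≤m′ , seen) , one′ =
  suc m , suc t , suc (suc m′) ,
  (s≤s z≤n , OneAtFront.deck≗ one 0) , (s≤s z≤n , seen) , (s≤s z≤n , OneAtFront.deck≗ one′ 0) ,
  s≤s m+k≤t , s≤s (s≤s t≤m′)
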